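{- Let $m\ge 1$ and $b\ge 0$ be integers, and let $\gamma$ and $\delta$ be partitions of $b$ with every part at most $m$. Write $\gamma_i$ (resp. $\delta_i$) for the number of parts of $\gamma$ (resp. $\delta$) equal to $i$, for $1\le i\le m$. Define $a_{\gamma,\delta}$ as follows: take rows $r_0,r_1,\ldots,r_\ell$, where $\ell$ is the number of parts of $\gamma$, row $r_0$ has capacity $m$ and row $r_j$ ($1\le j\le \ell$) has capacity equal to the $j$-th part of $\gamma$ (rows are distinguishable even if capacities coincide). Consider all ways to choose nonnegative integers $c_0,c_1,\ldots,c_\ell$ with $c_0+c_1+\cdots+c_\ell=m$ and $c_j$ at most the capacity of $r_j$ for each $j$ (i.e., multisets of $m$ rows using each row at most its capacity). For each such choice, the residual capacities (capacity of $r_j$ minus $c_j$), after discarding zeros and sorting, form a partition of $b$; $a_{\gamma,\delta}$ is the number of choices for which this partition equals $\delta$. Then \[ a_{\gamma,\delta}=\prod_{i=1}^m\binom{(\gamma_i+\cdots+\gamma_m)+1-(\delta_{i+1}+\cdots+\delta_m)}{\delta_i}, \] where an empty sum is $0$ and $\binom{N}{k}=0$ whenever $k>N$.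
   Context: These coefficients $a_{\gamma,\delta}$ arise as follows. For multiplex juggling with $b$ balls and capacity $m$, for each partition $\gamma$ of $b$ into parts at most $m$ one defines $x_\gamma(k)$ as a count of walks in the state diagram whose terminal landing schedule corresponds to $\gamma$; these satisfy the linear recurrence $x_\gamma(k)=\sum_\delta a_{\gamma,\delta}x_\delta(k-1)$, where $a_{\gamma,\delta}$ counts the ways of filling the last block of $m$ columns (one chosen $1$ per column, weakly monotone within the block) in rows with row sums $m$ followed by the parts of $\gamma$, such that the remaining row sums form the partition $\delta$ — which is exactly the count described in the claim. -}

module Defs where

open import Data.Nat using (ℕ; zero; suc; _+_; _∸_; _≤_; _≤?_; _≟_)
open import Data.Nat.Properties using (≤-decTotalOrder)
open import Data.Nat.Combinatorics using (_C_)
open import Data.Nat.ListAction using (sum; product)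
open import Data.List using (List; []; _∷_; [_]; map; concatMap; upTo; length; filter; reverse; zipWith)
open import Data.List.Properties using (≡-dec)
open import Data.List.Relation.Unary.All using (All)
open import Data.List.Relation.Unary.Linked using (Linked)
open import Data.Product using (_×_)
open import Relation.Nullary using (yes; no)
open import Relation.Nullary.Decidable using (_×-dec_)
open import Relation.Binary.PropositionalEquality using (_≡_)
import Data.List.Sort.MergeSort as MS

IsPartition : ℕ → ℕ → List ℕ → Set
IsPartition m b γ = All (λ x → 1 ≤ x × x ≤ m) γ × Linked (λ x y → y ≤ x) γ × sum γ ≡ b

mult : ℕ → List ℕ → ℕ
mult i γ = length (filter (λ x → x ≟ i) γ)

sortDesc : List ℕ → List ℕ
sortDesc xs = reverse (MS.sort ≤-decTotalOrder xs)

boxes : List ℕ → List (List ℕ)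
boxes [] = [ [] ]
boxes (k ∷ ks) = concatMap (λ c → map (c ∷_) (boxes ks)) (upTo (suc k))

caps : ℕ → List ℕ → List ℕ
caps m γ = m ∷ γ

residual : List ℕ → List ℕ → List ℕ
residual cs c = sortDesc (filter (λ x → 1 ≤? x) (zipWith _∸_ cs c))

a : ℕ → List ℕ → List ℕ → ℕ
a m γ δ = length (filter (λ c → (sum c ≟ m) ×-dec ≡-dec _≟_ (residual (caps m γ) c) δ)
                        (boxes (caps m γ)))

tailMult : ℕ → ℕ → List ℕ → ℕ
tailMult m i γ = sum (map (λ k → mult (i + k) γ) (upTo (suc m ∸ i)))

-- binomial coefficient with integer top N = p - q, and (N choose k) = 0 when k > N
-- (in particular whenever N < 0)
binomDiff : ℕ → ℕ → ℕ → ℕ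
binomDiff p q k with q ≤? p
... | yes _ = (p ∸ q) C k
... | no  _ = 0

formula : ℕ → List ℕ → List ℕ → ℕ
formula m γ δ = product (map (λ i → binomDiff (tailMult m i γ + 1) (tailMult m (suc i) δ) (mult i δ))
                             (map suc (upTo m)))

-- Writing r_j = cap(r_j) − c_j, a choice is counted by a_{γ,δ} exactly when the value
-- i occurs δ_i times among the residuals r_j, for 1 ≤ i ≤ m (then Σ c_j = m holds
-- automatically, since both sides sum to b). Such residual vectors are counted by
-- handing out the values from m down to 1: the value i goes to δ_i of the rows of
-- capacity ≥ i not already holding a larger value. There are (γ_i + ⋯ + γ_m) + 1 rows
-- of capacity ≥ i, of which δ_{i+1} + ⋯ + δ_m are taken, which gives the i-th
-- binomial factor. Formally, the count and the product satisfy the same recursion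
-- when a row is added (Pascal's rule for the top value) and agree when there are no rows.

module Submission where

open import Defs
open import Data.Nat
open import Data.Nat.Properties
open import Data.Nat.Combinatorics using (_C_; nCk+nC[k+1]≡[n+1]C[k+1]; k>n⇒nCk≡0)
open import Data.Nat.ListAction using (sum; product)
open import Data.Nat.ListAction.Properties using (sum-↭; product-++)
open import Data.List using (List; []; _∷_; [_]; _++_; map; concatMap; upTo; applyUpTo; length; filter; zipWith; reverse)
open import Data.List.Properties using (filter-++; length-++; filter-accept; filter-reject; filter-none; map-cong; map-++; map-upTo; upTo-∷ʳ; unfold-reverse)
open import Data.List.Relation.Unary.All as All using (All; []; _∷_)
import Data.List.Relation.Unary.All.Properties as All
open import Data.List.Relation.Unary.AllPairs using (AllPairs; []; _∷_)
import Data.List.Relation.Unary.AllPairs.Properties as AllPairs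
open import Data.List.Relation.Unary.Linked.Properties using (Linked⇒AllPairs)
open import Data.List.Relation.Binary.Permutation.Propositional using (_↭_; ↭-sym; ↭-trans)
open import Data.List.Relation.Binary.Permutation.Propositional.Properties using (filter-↭; ↭-length; ↭-reverse; All-resp-↭)
import Data.List.Sort.MergeSort.Properties as MergeSort
open import Data.Product using (_×_; _,_; proj₁; proj₂)
open import Data.Sum using (inj₁; inj₂)
open import Data.Empty using (⊥-elim)
open import Function using (_∘_; flip)
open import Relation.Nullary using (yes; no; ¬_; Dec; _×-dec_)
open import Relation.Unary using (Decidable)
open import Relation.Binary.Definitions using (tri<; tri≈; tri>)
open import Relation.Binary.PropositionalEquality hiding ([_])
open import Algebra.Properties.CommutativeSemigroup +-commutativeSemigroup using () renaming (interchange to +-interchange)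

-- Indicators and binomial coefficients

χ≤ : ℕ → ℕ → ℕ
χ≤ zero    _       = 1
χ≤ (suc u) zero    = 0
χ≤ (suc u) (suc c) = χ≤ u c

χ≡ : ℕ → ℕ → ℕ
χ≡ zero    zero    = 1
χ≡ zero    (suc _) = 0
χ≡ (suc _) zero    = 0
χ≡ (suc x) (suc y) = χ≡ x y

whenPos : ℕ → ℕ → ℕ
whenPos zero    _ = 0
whenPos (suc _) x = x

χ≤-≤ : ∀ {u c} → u ≤ c → χ≤ u c ≡ 1
χ≤-≤ {zero}              _         = refl
χ≤-≤ {suc u} {suc c} (s≤s u≤c) = χ≤-≤ u≤c

χ≤-> : ∀ {u c} → c < u → χ≤ u c ≡ 0
χ≤-> {suc u} {zero}  _         = refl
χ≤-> {suc u} {suc c} (s≤s c<u) = χ≤-> c<u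

χ≤-antitone : ∀ u c → χ≤ (suc u) c ≤ χ≤ u c
χ≤-antitone zero    zero    = z≤n
χ≤-antitone zero    (suc c) = ≤-refl
χ≤-antitone (suc u) zero    = z≤n
χ≤-antitone (suc u) (suc c) = χ≤-antitone u c

χ≡-refl : ∀ x → χ≡ x x ≡ 1
χ≡-refl zero    = refl
χ≡-refl (suc x) = χ≡-refl x

χ≡-≢ : ∀ {x y} → x ≢ y → χ≡ x y ≡ 0
χ≡-≢ {zero}  {zero}  x≢y = ⊥-elim (x≢y refl)
χ≡-≢ {zero}  {suc y} _   = refl
χ≡-≢ {suc x} {zero}  _   = refl
χ≡-≢ {suc x} {suc y} x≢y = χ≡-≢ (x≢y ∘ cong suc)

χ≡+χ≤-suc : ∀ x u → χ≡ x u + χ≤ (suc u) x ≡ χ≤ u x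
χ≡+χ≤-suc zero    zero    = refl
χ≡+χ≤-suc (suc x) zero    = refl
χ≡+χ≤-suc zero    (suc u) = refl
χ≡+χ≤-suc (suc x) (suc u) = χ≡+χ≤-suc x u

whenPos-*ʳ : ∀ k x y → whenPos k (x * y) ≡ x * whenPos k y
whenPos-*ʳ zero    x y = sym (*-zeroʳ x)
whenPos-*ʳ (suc k) x y = refl

binomDiff-≤ : ∀ {p q} k → q ≤ p → binomDiff p q k ≡ (p ∸ q) C k
binomDiff-≤ {p} {q} k q≤p with q ≤? p
... | yes _   = refl
... | no  q≰p = ⊥-elim (q≰p q≤p)

binomDiff-suc-suc : ∀ p q k → binomDiff (suc p) (suc q) k ≡ binomDiff p q k
binomDiff-suc-suc p q k with q ≤? p
... | yes q≤p = binomDiff-≤ k (s≤s q≤p)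
... | no  q≰p with suc q ≤? suc p
...   | yes (s≤s q≤p) = ⊥-elim (q≰p q≤p)
...   | no  _         = refl

binomDiff-zero : ∀ {p q} → q ≤ p → binomDiff p q 0 ≡ 1
binomDiff-zero = binomDiff-≤ 0

binomDiff-large : ∀ {p q k} → p < q + k → binomDiff p q k ≡ 0
binomDiff-large {p} {q} {k} p<q+k with q ≤? p
... | no  _   = refl
... | yes q≤p = k>n⇒nCk≡0 (+-cancelˡ-< q (p ∸ q) k (subst (_< q + k) (sym (m+[n∸m]≡n q≤p)) p<q+k))

binomDiff-pascal : ∀ {p q} k → q ≤ p →
                   binomDiff (suc p) q (suc k) ≡ binomDiff p q (suc k) + binomDiff p q k
binomDiff-pascal {p} {q} k q≤p = begin
  binomDiff (suc p) q (suc k)         ≡⟨ binomDiff-≤ (suc k) (m≤n⇒m≤1+n q≤p) ⟩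
  (suc p ∸ q) C suc k                 ≡⟨ cong (_C suc k) (+-∸-assoc 1 q≤p) ⟩
  suc (p ∸ q) C suc k                 ≡⟨ sym (nCk+nC[k+1]≡[n+1]C[k+1] (p ∸ q) k) ⟩
  (p ∸ q) C k + (p ∸ q) C suc k       ≡⟨ +-comm ((p ∸ q) C k) _ ⟩
  (p ∸ q) C suc k + (p ∸ q) C k       ≡⟨ sym (cong₂ _+_ (binomDiff-≤ (suc k) q≤p) (binomDiff-≤ k q≤p)) ⟩
  binomDiff p q (suc k) + binomDiff p q k ∎
  where open ≡-Reasoning

-- Pascal's rule for one extra row: it either stays free, or it takes one of the F
-- places and is occupied from then on (the hypothesis relating X and Y).
binomDiff-suc-split : ∀ {N D} F X (Y : ℕ → ℕ) → D ≤ N → (∀ F' → F ≡ suc F' → X ≡ Y F') →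
                      binomDiff (suc N) D F * X ≡ binomDiff N D F * X + whenPos F (binomDiff N D (F ∸ 1) * Y (F ∸ 1))
binomDiff-suc-split {N} {D} zero X Y D≤N _
  rewrite binomDiff-zero (m≤n⇒m≤1+n D≤N) | binomDiff-zero D≤N = sym (+-identityʳ (1 * X))
binomDiff-suc-split {N} {D} (suc F') X Y D≤N X≡Y rewrite binomDiff-pascal F' D≤N | X≡Y F' refl =
  *-distribʳ-+ (Y F') (binomDiff N D (suc F')) (binomDiff N D F')

sumBelow : ℕ → (ℕ → ℕ) → ℕ
sumBelow zero    g = 0
sumBelow (suc k) g = g 0 + sumBelow k (g ∘ suc)

sumBelow-cong : ∀ k {g h} → (∀ j → j < k → g j ≡ h j) → sumBelow k g ≡ sumBelow k h
sumBelow-cong zero    _   = refl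
sumBelow-cong (suc k) g≗h = cong₂ _+_ (g≗h 0 z<s) (sumBelow-cong k (λ j j<k → g≗h (suc j) (s≤s j<k)))

sumBelow-zero : ∀ k → sumBelow k (λ _ → 0) ≡ 0
sumBelow-zero zero    = refl
sumBelow-zero (suc k) = sumBelow-zero k

sumBelow-+ : ∀ k g h → sumBelow k (λ j → g j + h j) ≡ sumBelow k g + sumBelow k h
sumBelow-+ zero    g h = refl
sumBelow-+ (suc k) g h =
  trans (cong (g 0 + h 0 +_) (sumBelow-+ k (g ∘ suc) (h ∘ suc))) (+-interchange (g 0) (h 0) _ _)

sumBelow-*ˡ : ∀ k x g → sumBelow k (λ j → x * g j) ≡ x * sumBelow k g
sumBelow-*ˡ zero    x g = sym (*-zeroʳ x)
sumBelow-*ˡ (suc k) x g = trans (cong (x * g 0 +_) (sumBelow-*ˡ k x (g ∘ suc))) (sym (*-distribˡ-+ x (g 0) _))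

sumBelow-suc : ∀ k g → sumBelow (suc k) g ≡ sumBelow k g + g k
sumBelow-suc zero    g = +-comm (g 0) 0
sumBelow-suc (suc k) g = trans (cong (g 0 +_) (sumBelow-suc k (g ∘ suc))) (sym (+-assoc (g 0) _ _))

sumBelow-reverse : ∀ k g → sumBelow (suc k) (λ j → g (k ∸ j)) ≡ sumBelow (suc k) g
sumBelow-reverse zero    g = refl
sumBelow-reverse (suc k) g = begin
  g (suc k) + sumBelow (suc k) (λ j → g (k ∸ j)) ≡⟨ cong (g (suc k) +_) (sumBelow-reverse k g) ⟩
  g (suc k) + sumBelow (suc k) g                 ≡⟨ +-comm (g (suc k)) _ ⟩
  sumBelow (suc k) g + g (suc k)                 ≡⟨ sym (sumBelow-suc (suc k) g) ⟩
  sumBelow (suc (suc k)) g                       ∎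
  where open ≡-Reasoning

sum-applyUpTo : ∀ (g : ℕ → ℕ) k → sum (applyUpTo g k) ≡ sumBelow k g
sum-applyUpTo g zero    = refl
sum-applyUpTo g (suc k) = cong (g 0 +_) (sum-applyUpTo (g ∘ suc) k)

sumBelow-χ≡ : ∀ k v x → sumBelow k (λ j → χ≡ j v * x) ≡ χ≤ (suc v) k * x
sumBelow-χ≡ zero    v       x = refl
sumBelow-χ≡ (suc k) zero    x = trans (cong (x + 0 +_) (sumBelow-zero k)) (+-identityʳ _)
sumBelow-χ≡ (suc k) (suc v) x = sumBelow-χ≡ k v x

sumBelow-χ≡-from : ∀ k u x → x < u + k → sumBelow k (λ j → χ≡ x (u + j)) ≡ χ≤ u x
sumBelow-χ≡-from zero    u x x<u+0 = sym (χ≤-> (subst (x <_) (+-identityʳ u) x<u+0))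
sumBelow-χ≡-from (suc k) u x x<u+k = begin
  χ≡ x (u + 0) + sumBelow k (λ j → χ≡ x (u + suc j))
    ≡⟨ cong₂ _+_ (cong (χ≡ x) (+-identityʳ u)) (sumBelow-cong k (λ j _ → cong (χ≡ x) (+-suc u j))) ⟩
  χ≡ x u + sumBelow k (λ j → χ≡ x (suc u + j))
    ≡⟨ cong (χ≡ x u +_) (sumBelow-χ≡-from k (suc u) x (subst (x <_) (+-suc u k) x<u+k)) ⟩
  χ≡ x u + χ≤ (suc u) x
    ≡⟨ χ≡+χ≤-suc x u ⟩
  χ≤ u x ∎
  where open ≡-Reasoning

product-map-upTo-suc : ∀ (F : ℕ → ℕ) v →
                       product (map F (map suc (upTo (suc v)))) ≡ product (map F (map suc (upTo v))) * F (suc v)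
product-map-upTo-suc F v = begin
  product (map F (map suc (upTo (suc v))))      ≡⟨ cong (product ∘ map F ∘ map suc) (sym (upTo-∷ʳ v)) ⟩
  product (map F (map suc (upTo v ++ [ v ])))   ≡⟨ cong (product ∘ map F) (map-++ suc (upTo v) [ v ]) ⟩
  product (map F (map suc (upTo v) ++ [ suc v ])) ≡⟨ cong product (map-++ F (map suc (upTo v)) [ suc v ]) ⟩
  product (Fs ++ [ F (suc v) ])                 ≡⟨ product-++ Fs [ F (suc v) ] ⟩
  product Fs * (F (suc v) * 1)                  ≡⟨ cong (product Fs *_) (*-identityʳ (F (suc v))) ⟩
  product Fs * F (suc v)                        ∎
  where
  open ≡-Reasoning
  Fs = map F (map suc (upTo v))

-- Multiplicities and sorting

module _ {A : Set} {P Q : A → Set} (P? : Decidable P) (Q? : Decidable Q) where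

  length-filter-cong : ∀ {xs} → All (λ x → (P x → Q x) × (Q x → P x)) xs →
                       length (filter P? xs) ≡ length (filter Q? xs)
  length-filter-cong {[]}     []                  = refl
  length-filter-cong {x ∷ xs} ((P⇒Q , Q⇒P) ∷ PQs) with P? x | Q? x
  ... | yes _  | yes _  = cong suc (length-filter-cong PQs)
  ... | yes px | no ¬qx = ⊥-elim (¬qx (P⇒Q px))
  ... | no ¬px | yes qx = ⊥-elim (¬px (Q⇒P qx))
  ... | no _   | no _   = length-filter-cong PQs

module _ {A : Set} {P : A → Set} (P? : Decidable P) where

  length-filter-map : ∀ {B : Set} (g : B → A) xs → length (filter P? (map g xs)) ≡ length (filter (P? ∘ g) xs)
  length-filter-map g []       = refl
  length-filter-map g (x ∷ xs) with P? (g x)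
  ... | yes _ = cong suc (length-filter-map g xs)
  ... | no  _ = length-filter-map g xs

  length-filter-concatMap : ∀ {B : Set} (g : B → List A) xs →
                            length (filter P? (concatMap g xs)) ≡ sum (map (λ x → length (filter P? (g x))) xs)
  length-filter-concatMap g []       = refl
  length-filter-concatMap g (x ∷ xs) = begin
    length (filter P? (g x ++ concatMap g xs))               ≡⟨ cong length (filter-++ P? (g x) (concatMap g xs)) ⟩
    length (filter P? (g x) ++ filter P? (concatMap g xs))   ≡⟨ length-++ (filter P? (g x)) ⟩
    length (filter P? (g x)) + length (filter P? (concatMap g xs))
                                                             ≡⟨ cong (length (filter P? (g x)) +_) (length-filter-concatMap g xs) ⟩
    length (filter P? (g x)) + sum (map (λ y → length (filter P? (g y))) xs) ∎
    where open ≡-Reasoning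

mult-∷ : ∀ i x r → mult i (x ∷ r) ≡ χ≡ x i + mult i r
mult-∷ i x r with x ≟ i
... | yes refl = trans (cong length (filter-accept (_≟ i) {x} {r} refl)) (cong (_+ mult i r) (sym (χ≡-refl i)))
... | no  x≢i  = trans (cong length (filter-reject (_≟ i) {x} {r} x≢i)) (cong (_+ mult i r) (sym (χ≡-≢ x≢i)))

mult-∷-≡ : ∀ i r → mult i (i ∷ r) ≡ suc (mult i r)
mult-∷-≡ i r = trans (mult-∷ i i r) (cong (_+ mult i r) (χ≡-refl i))

mult-∷-≢ : ∀ {i x} r → x ≢ i → mult i (x ∷ r) ≡ mult i r
mult-∷-≢ {i} {x} r x≢i = trans (mult-∷ i x r) (cong (_+ mult i r) (χ≡-≢ x≢i))

mult-↭ : ∀ i {xs ys} → xs ↭ ys → mult i xs ≡ mult i ys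
mult-↭ i xs↭ys = ↭-length (filter-↭ (_≟ i) xs↭ys)

mult-absent : ∀ i xs → All (_≢ i) xs → mult i xs ≡ 0
mult-absent i []       []         = refl
mult-absent i (x ∷ xs) (x≢i ∷ ps) = trans (mult-∷-≢ xs x≢i) (mult-absent i xs ps)

AllPairs-reverse : ∀ {A : Set} {R : A → A → Set} {xs} → AllPairs R xs → AllPairs (flip R) (reverse xs)
AllPairs-reverse                    []         = []
AllPairs-reverse {xs = x ∷ xs} (Rx ∷ Rxs) rewrite unfold-reverse x xs =
  AllPairs.++⁺ (AllPairs-reverse Rxs) ([] ∷ []) (All-resp-↭ (↭-sym (↭-reverse xs)) (All.map (_∷ []) Rx))

sortDesc-↭ : ∀ xs → sortDesc xs ↭ xs
sortDesc-↭ xs = ↭-trans (↭-reverse _) (MergeSort.sort-↭ ≤-decTotalOrder xs)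

sortDesc-descending : ∀ xs → AllPairs _≥_ (sortDesc xs)
sortDesc-descending xs = AllPairs-reverse (Linked⇒AllPairs ≤-trans (MergeSort.sort-↗ ≤-decTotalOrder xs))

mult-above-head : ∀ {x y xs} → All (_≤ x) xs → x < y → mult y (x ∷ xs) ≡ 0
mult-above-head {x} {y} {xs} xs≤x x<y = mult-absent y (x ∷ xs) (<⇒≢ x<y ∷ All.map (λ z≤x → <⇒≢ (≤-<-trans z≤x x<y)) xs≤x)

mult-∷-≢0 : ∀ i r → mult i (i ∷ r) ≢ 0
mult-∷-≢0 i r eq = 1+n≢0 (trans (sym (mult-∷-≡ i r)) eq)

descending-mult-injective : ∀ {xs ys} → AllPairs _≥_ xs → AllPairs _≥_ ys →
                            (∀ i → mult i xs ≡ mult i ys) → xs ≡ ys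
descending-mult-injective {[]}     {[]}     _ _ _  = refl
descending-mult-injective {[]}     {y ∷ ys} _ _ eq = ⊥-elim (mult-∷-≢0 y ys (sym (eq y)))
descending-mult-injective {x ∷ xs} {[]}     _ _ eq = ⊥-elim (mult-∷-≢0 x xs (eq x))
descending-mult-injective {x ∷ xs} {y ∷ ys} (xs≤x ∷ xs↘) (ys≤y ∷ ys↘) eq with <-cmp x y
... | tri< x<y _ _ = ⊥-elim (mult-∷-≢0 y ys (trans (sym (eq y)) (mult-above-head xs≤x x<y)))
... | tri> _ _ y<x = ⊥-elim (mult-∷-≢0 x xs (trans (eq x) (mult-above-head ys≤y y<x)))
... | tri≈ _ refl _ = cong (x ∷_) (descending-mult-injective xs↘ ys↘ (λ i →
  +-cancelˡ-≡ (χ≡ x i) _ _ (trans (sym (mult-∷ i x xs)) (trans (eq i) (mult-∷ i x ys)))))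

InRange : ℕ → ℕ → Set
InRange m x = 1 ≤ x × x ≤ m

mult-out-of-range : ∀ {m i} xs → All (InRange m) xs → ¬ InRange m i → mult i xs ≡ 0
mult-out-of-range {m} {i} xs xs∈ i∉ = mult-absent i xs (All.map (λ x∈ x≡i → i∉ (subst (InRange m) x≡i x∈)) xs∈)

pos? : Decidable (1 ≤_)
pos? x = 1 ≤? x

mult-filter-pos : ∀ i → 1 ≤ i → ∀ xs → mult i (filter pos? xs) ≡ mult i xs
mult-filter-pos i 1≤i []           = refl
mult-filter-pos i 1≤i (zero  ∷ xs) = trans (mult-filter-pos i 1≤i xs) (sym (mult-∷-≢ xs (<⇒≢ 1≤i)))
mult-filter-pos i 1≤i (suc x ∷ xs) = begin
  mult i (suc x ∷ filter pos? xs)       ≡⟨ mult-∷ i (suc x) _ ⟩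
  χ≡ (suc x) i + mult i (filter pos? xs) ≡⟨ cong (χ≡ (suc x) i +_) (mult-filter-pos i 1≤i xs) ⟩
  χ≡ (suc x) i + mult i xs              ≡⟨ sym (mult-∷ i (suc x) xs) ⟩
  mult i (suc x ∷ xs)                   ∎
  where open ≡-Reasoning

sum-filter-pos : ∀ xs → sum (filter pos? xs) ≡ sum xs
sum-filter-pos []           = refl
sum-filter-pos (zero  ∷ xs) = sum-filter-pos xs
sum-filter-pos (suc x ∷ xs) = cong (suc x +_) (sum-filter-pos xs)

zipWith-∸-≤ : ∀ {m} cs c → All (_≤ m) cs → All (_≤ m) (zipWith _∸_ cs c)
zipWith-∸-≤ []       _       _            = []
zipWith-∸-≤ (k ∷ ks) []      _            = []
zipWith-∸-≤ (k ∷ ks) (x ∷ c) (k≤m ∷ ks≤m) = ≤-trans (m∸n≤m k x) k≤m ∷ zipWith-∸-≤ ks c ks≤m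

boxes-sum : ∀ cs → All (λ c → sum c + sum (zipWith _∸_ cs c) ≡ sum cs) (boxes cs)
boxes-sum []       = refl ∷ []
boxes-sum (k ∷ ks) = All.concat⁺ (All.map⁺ (All.applyUpTo⁺₁ (λ x → x) (suc k) (λ {x} x<1+k →
  All.map⁺ (All.map (λ {c} → split x (sum c) (sum (zipWith _∸_ ks c)) (≤-pred x<1+k)) (boxes-sum ks)))))
  where
  split : ∀ x s t → x ≤ k → s + t ≡ sum ks → x + s + (k ∸ x + t) ≡ k + sum ks
  split x s t x≤k s+t≡ = begin
    x + s + (k ∸ x + t)   ≡⟨ +-interchange x s (k ∸ x) t ⟩
    x + (k ∸ x) + (s + t) ≡⟨ cong₂ _+_ (m+[n∸m]≡n x≤k) s+t≡ ⟩
    k + sum ks            ∎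
    where open ≡-Reasoning

-- Placing values into rows

-- n u rows can take the value u (n is antitone) and D rows are already occupied;
-- placements n f v D counts the ways to give each value u = v, v-1, …, 1 to exactly
-- f u distinct free rows.
placements : (ℕ → ℕ) → (ℕ → ℕ) → ℕ → ℕ → ℕ
placements n f zero    D = 1
placements n f (suc v) D = binomDiff (n (suc v)) D (f (suc v)) * placements n f v (D + f (suc v))

decAt : ℕ → (ℕ → ℕ) → ℕ → ℕ
decAt w f u with u ≟ w
... | yes _ = f u ∸ 1
... | no  _ = f u

decAt-≡ : ∀ w f → decAt w f w ≡ f w ∸ 1
decAt-≡ w f with w ≟ w
... | yes _   = refl
... | no  w≢w = ⊥-elim (w≢w refl)

decAt-≢ : ∀ {w u} f → u ≢ w → decAt w f u ≡ f u
decAt-≢ {w} {u} f u≢w with u ≟ w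
... | yes u≡w = ⊥-elim (u≢w u≡w)
... | no  _   = refl

addRow : ℕ → (ℕ → ℕ) → ℕ → ℕ
addRow c n u = χ≤ u c + n u

-- The terms in which the new row (of capacity c) receives the value j+1.
newRowTerms : (n f : ℕ → ℕ) (c v D : ℕ) → ℕ
newRowTerms n f c v D =
  sumBelow c (λ j → χ≤ (suc j) v * whenPos (f (suc j)) (placements n (decAt (suc j) f) v D))

placements-cong : ∀ n {f g} v D → (∀ u → u < v → f (suc u) ≡ g (suc u)) →
                  placements n f v D ≡ placements n g v D
placements-cong n         zero    D _   = refl
placements-cong n {f} {g} (suc v) D f≗g rewrite f≗g v ≤-refl =
  cong (binomDiff (n (suc v)) D (g (suc v)) *_)
       (placements-cong n v (D + g (suc v)) (λ u u<v → f≗g u (m<n⇒m<1+n u<v)))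

-- While every remaining value is ≤ c the new row accepts all of them, so adding it
-- and occupying one more row cancel out.
placements-addRow-occupied : ∀ c n f v E → v ≤ c →
                             placements (addRow c n) f v (suc E) ≡ placements n f v E
placements-addRow-occupied c n f zero    E _   = refl
placements-addRow-occupied c n f (suc v) E v<c rewrite χ≤-≤ v<c =
  cong₂ _*_ (binomDiff-suc-suc (n (suc v)) E (f (suc v)))
            (placements-addRow-occupied c n f v (E + f (suc v)) (≤-trans (n≤1+n v) v<c))

module _ (n f : ℕ → ℕ) (c : ℕ) where

  private
    newRowTerm : ℕ → ℕ → ℕ → ℕ
    newRowTerm v D j = χ≤ (suc j) v * whenPos (f (suc j)) (placements n (decAt (suc j) f) v D)

    -- The new row takes the top value v+1.
    topValueTerm : ℕ → ℕ → ℕ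
    topValueTerm v D =
      whenPos (f (suc v)) (binomDiff (n (suc v)) D (f (suc v) ∸ 1) * placements n f v (D + (f (suc v) ∸ 1)))

    newRowTerm-suc : ∀ v D j → newRowTerm (suc v) D j ≡
                     binomDiff (n (suc v)) D (f (suc v)) * newRowTerm v (D + f (suc v)) j + χ≡ j v * topValueTerm v D
    newRowTerm-suc v D j with <-cmp j v
    ... | tri< j<v _ _
      rewrite χ≤-≤ {suc j} {suc v} (s≤s (<⇒≤ j<v)) | χ≤-≤ {suc j} {v} j<v | χ≡-≢ (<⇒≢ j<v)
            | decAt-≢ {suc j} {suc v} f (<⇒≢ j<v ∘ sym ∘ suc-injective)
      = begin
        1 * whenPos (f (suc j)) (B * P)     ≡⟨ *-identityˡ _ ⟩
        whenPos (f (suc j)) (B * P)         ≡⟨ whenPos-*ʳ (f (suc j)) B P ⟩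
        B * whenPos (f (suc j)) P           ≡⟨ cong (B *_) (sym (*-identityˡ _)) ⟩
        B * (1 * whenPos (f (suc j)) P)     ≡⟨ sym (+-identityʳ _) ⟩
        B * (1 * whenPos (f (suc j)) P) + 0 ∎
      where
      open ≡-Reasoning
      B = binomDiff (n (suc v)) D (f (suc v))
      P = placements n (decAt (suc j) f) v (D + f (suc v))
    ... | tri≈ _ refl _
      rewrite χ≤-≤ {suc j} {suc j} ≤-refl | χ≤-> {suc j} {j} ≤-refl | χ≡-refl j | decAt-≡ (suc j) f
            | placements-cong n {decAt (suc j) f} {f} j (D + (f (suc j) ∸ 1))
                              (λ u u<j → decAt-≢ f (<⇒≢ u<j ∘ suc-injective))
            | *-zeroʳ (binomDiff (n (suc j)) D (f (suc j)))
      = refl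
    ... | tri> _ _ v<j
      rewrite χ≤-> {suc j} {suc v} (s≤s v<j) | χ≤-> {suc j} {v} (m<n⇒m<1+n v<j) | χ≡-≢ (<⇒≢ v<j ∘ sym)
            | *-zeroʳ (binomDiff (n (suc v)) D (f (suc v)))
      = refl

  newRowTerms-suc : ∀ v D → newRowTerms n f c (suc v) D ≡
                    binomDiff (n (suc v)) D (f (suc v)) * newRowTerms n f c v (D + f (suc v))
                    + χ≤ (suc v) c * topValueTerm v D
  newRowTerms-suc v D = begin
    sumBelow c (λ j → newRowTerm (suc v) D j)
      ≡⟨ sumBelow-cong c (λ j _ → newRowTerm-suc v D j) ⟩
    sumBelow c (λ j → B * newRowTerm v (D + f (suc v)) j + χ≡ j v * topValueTerm v D)
      ≡⟨ sumBelow-+ c _ _ ⟩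
    sumBelow c (λ j → B * newRowTerm v (D + f (suc v)) j) + sumBelow c (λ j → χ≡ j v * topValueTerm v D)
      ≡⟨ cong₂ _+_ (sumBelow-*ˡ c B _) (sumBelow-χ≡ c v _) ⟩
    B * newRowTerms n f c v (D + f (suc v)) + χ≤ (suc v) c * topValueTerm v D ∎
    where
    open ≡-Reasoning
    B = binomDiff (n (suc v)) D (f (suc v))

  placements-addRow : (∀ u → n (suc u) ≤ n u) → ∀ v D → D ≤ n v →
                      placements (addRow c n) f v D ≡ placements n f v D + newRowTerms n f c v D
  placements-addRow _        zero    D _   = sym (cong (1 +_) (sumBelow-zero c))
  placements-addRow antitone (suc v) D D≤N = begin
    binomDiff (χ≤ (suc v) c + N) D F * X   ≡⟨ addedRowAtTop ⟩
    B * X + Top                            ≡⟨ cong (_+ Top) recurse ⟩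
    B * G + B * T + Top                    ≡⟨ +-assoc (B * G) (B * T) Top ⟩
    B * G + (B * T + Top)                  ≡⟨ cong (B * G +_) (sym (newRowTerms-suc v D)) ⟩
    B * G + newRowTerms n f c (suc v) D    ∎
    where
    open ≡-Reasoning
    N = n (suc v)
    F = f (suc v)
    B = binomDiff N D F
    X = placements (addRow c n) f v (D + F)
    G = placements n f v (D + F)
    T = newRowTerms n f c v (D + F)
    Top = χ≤ (suc v) c * topValueTerm v D

    recurse : B * X ≡ B * G + B * T
    recurse with D + F ≤? N
    ... | yes D+F≤N = trans (cong (B *_) (placements-addRow antitone v (D + F) (≤-trans D+F≤N (antitone v))))
                            (*-distribˡ-+ B G T)
    ... | no  D+F≰N rewrite binomDiff-large {N} {D} {F} (≰⇒> D+F≰N) = refl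

    occupiedAfterTop : suc v ≤ c → ∀ F' → F ≡ suc F' → X ≡ placements n f v (D + F')
    occupiedAfterTop v<c F' F≡ = begin
      placements (addRow c n) f v (D + F)        ≡⟨ cong (placements (addRow c n) f v ∘ (D +_)) F≡ ⟩
      placements (addRow c n) f v (D + suc F')   ≡⟨ cong (placements (addRow c n) f v) (+-suc D F') ⟩
      placements (addRow c n) f v (suc (D + F'))
                                                 ≡⟨ placements-addRow-occupied c n f v (D + F') (≤-trans (n≤1+n v) v<c) ⟩
      placements n f v (D + F')                  ∎

    addedRowAtTop : binomDiff (χ≤ (suc v) c + N) D F * X ≡ B * X + Top
    addedRowAtTop with suc v ≤? c
    ... | yes v<c rewrite χ≤-≤ v<c =
      trans (binomDiff-suc-split F X (placements n f v ∘ (D +_)) D≤N (occupiedAfterTop v<c))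
            (cong (B * X +_) (sym (*-identityˡ _)))
    ... | no  v≮c rewrite χ≤-> (≰⇒> v≮c) = sym (+-identityʳ (B * X))

-- Counting residual vectors

HasMults : ℕ → (ℕ → ℕ) → List ℕ → Set
HasMults M f r = ∀ i → 1 ≤ i → i ≤ M → mult i r ≡ f i

HasMults-suc : ∀ {M f r} → HasMults M f r → mult (suc M) r ≡ f (suc M) → HasMults (suc M) f r
HasMults-suc {M} hm top i 1≤i i≤1+M with m≤n⇒m<n∨m≡n i≤1+M
... | inj₁ i≤M  = hm i 1≤i (≤-pred i≤M)
... | inj₂ refl = top

hasMults? : ∀ M f r → Dec (HasMults M f r)
hasMults? zero    f r = yes (λ i 1≤i i≤0 → ⊥-elim (<⇒≱ 1≤i i≤0))
hasMults? (suc M) f r with hasMults? M f r | mult (suc M) r ≟ f (suc M)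
... | yes hm  | yes top  = yes (HasMults-suc {r = r} hm top)
... | no  ¬hm | _        = no (λ hm → ¬hm (λ i 1≤i i≤M → hm i 1≤i (m≤n⇒m≤1+n i≤M)))
... | _       | no  ¬top = no (λ hm → ¬top (hm (suc M) (s≤s z≤n) ≤-refl))

HasMults-0∷⁻ : ∀ {M f r} → HasMults M f (0 ∷ r) → HasMults M f r
HasMults-0∷⁻ {r = r} hm i 1≤i i≤M = trans (sym (mult-∷-≢ r (<⇒≢ 1≤i))) (hm i 1≤i i≤M)

HasMults-0∷⁺ : ∀ {M f r} → HasMults M f r → HasMults M f (0 ∷ r)
HasMults-0∷⁺ {r = r} hm i 1≤i i≤M = trans (mult-∷-≢ r (<⇒≢ 1≤i)) (hm i 1≤i i≤M)

HasMults-∷-absent : ∀ {M f w} r → suc w ≤ M → f (suc w) ≡ 0 → ¬ HasMults M f (suc w ∷ r)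
HasMults-∷-absent {w = w} r w<M fw≡0 hm = mult-∷-≢0 (suc w) r (trans (hm (suc w) (s≤s z≤n) w<M) fw≡0)

HasMults-∷⁻ : ∀ {M f w r} → HasMults M f (suc w ∷ r) → HasMults M (decAt (suc w) f) r
HasMults-∷⁻ {f = f} {w} {r} hm i 1≤i i≤M with suc w ≟ i
... | yes refl = trans (cong (_∸ 1) (trans (sym (mult-∷-≡ i r)) (hm i 1≤i i≤M))) (sym (decAt-≡ i f))
... | no  w≢i  = trans (sym (mult-∷-≢ r w≢i)) (trans (hm i 1≤i i≤M) (sym (decAt-≢ f (w≢i ∘ sym))))

HasMults-∷⁺ : ∀ {M f w q r} → f (suc w) ≡ suc q →
              HasMults M (decAt (suc w) f) r → HasMults M f (suc w ∷ r)
HasMults-∷⁺ {f = f} {w} {r = r} fw≡ hm i 1≤i i≤M with suc w ≟ i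
... | yes refl = begin
  mult i (i ∷ r)          ≡⟨ mult-∷-≡ i r ⟩
  suc (mult i r)          ≡⟨ cong suc (trans (hm i 1≤i i≤M) (decAt-≡ i f)) ⟩
  suc (f i ∸ 1)           ≡⟨ cong (suc ∘ (_∸ 1)) fw≡ ⟩
  suc _                   ≡⟨ sym fw≡ ⟩
  f i                     ∎
  where open ≡-Reasoning
... | no  w≢i  = trans (mult-∷-≢ r w≢i) (trans (hm i 1≤i i≤M) (decAt-≢ f (w≢i ∘ sym)))

countResiduals : ℕ → List ℕ → (ℕ → ℕ) → ℕ
countResiduals M cs f = length (filter (λ c → hasMults? M f (zipWith _∸_ cs c)) (boxes cs))

countResidualsAfter : ℕ → List ℕ → (ℕ → ℕ) → ℕ → ℕ
countResidualsAfter M ks f zero    = countResiduals M ks f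
countResidualsAfter M ks f (suc w) = whenPos (f (suc w)) (countResiduals M ks (decAt (suc w) f))

countResiduals-first : ∀ M ks f v → v ≤ M →
  length (filter (λ c → hasMults? M f (v ∷ zipWith _∸_ ks c)) (boxes ks)) ≡ countResidualsAfter M ks f v
countResiduals-first M ks f zero    _ =
  length-filter-cong _ _ (All.universal (λ _ → HasMults-0∷⁻ , HasMults-0∷⁺) (boxes ks))
countResiduals-first M ks f (suc w) w<M with f (suc w) in fw≡
... | zero  = cong length (filter-none _ (All.universal (λ c → HasMults-∷-absent _ w<M fw≡) (boxes ks)))
... | suc q = length-filter-cong _ _ (All.universal (λ _ → HasMults-∷⁻ , HasMults-∷⁺ fw≡) (boxes ks))

countResiduals-∷ : ∀ M k ks f → k ≤ M →
                   countResiduals M (k ∷ ks) f ≡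
                   countResiduals M ks f + sumBelow k (λ j → whenPos (f (suc j)) (countResiduals M ks (decAt (suc j) f)))
countResiduals-∷ M k ks f k≤M = begin
  countResiduals M (k ∷ ks) f
    ≡⟨ length-filter-concatMap _ (λ c → map (c ∷_) (boxes ks)) (upTo (suc k)) ⟩
  sum (map (λ c → length (filter Q (map (c ∷_) (boxes ks)))) (upTo (suc k)))
    ≡⟨ cong sum (map-cong firstResidual (upTo (suc k))) ⟩
  sum (map (countResidualsAfter M ks f ∘ (k ∸_)) (upTo (suc k)))
    ≡⟨ cong sum (map-upTo (countResidualsAfter M ks f ∘ (k ∸_)) (suc k)) ⟩
  sum (applyUpTo (countResidualsAfter M ks f ∘ (k ∸_)) (suc k))
    ≡⟨ sum-applyUpTo (countResidualsAfter M ks f ∘ (k ∸_)) (suc k) ⟩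
  sumBelow (suc k) (countResidualsAfter M ks f ∘ (k ∸_))
    ≡⟨ sumBelow-reverse k (countResidualsAfter M ks f) ⟩
  countResiduals M ks f + sumBelow k (λ j → whenPos (f (suc j)) (countResiduals M ks (decAt (suc j) f))) ∎
  where
  open ≡-Reasoning
  Q = λ c → hasMults? M f (zipWith _∸_ (k ∷ ks) c)

  firstResidual : ∀ c → length (filter Q (map (c ∷_) (boxes ks))) ≡ countResidualsAfter M ks f (k ∸ c)
  firstResidual c = trans (length-filter-map Q (c ∷_) (boxes ks))
                          (countResiduals-first M ks f (k ∸ c) (≤-trans (m∸n≤m k c) k≤M))

rowsAtLeast : List ℕ → ℕ → ℕ
rowsAtLeast []       _ = 0
rowsAtLeast (c ∷ cs)   = addRow c (rowsAtLeast cs)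

rowsAtLeast-antitone : ∀ cs u → rowsAtLeast cs (suc u) ≤ rowsAtLeast cs u
rowsAtLeast-antitone []       u = z≤n
rowsAtLeast-antitone (c ∷ cs) u = +-mono-≤ (χ≤-antitone u c) (rowsAtLeast-antitone cs u)

placements-noRows≡1 : ∀ f v → HasMults v f [] → placements (λ _ → 0) f v 0 ≡ 1
placements-noRows≡1 f zero    _  = refl
placements-noRows≡1 f (suc v) hm rewrite sym (hm (suc v) (s≤s z≤n) ≤-refl) =
  trans (*-identityˡ _) (placements-noRows≡1 f v (λ i 1≤i i≤v → hm i 1≤i (m≤n⇒m≤1+n i≤v)))

placements-noRows≡0 : ∀ f v D → ¬ HasMults v f [] → placements (λ _ → 0) f v D ≡ 0
placements-noRows≡0 f zero    D ¬hm = ⊥-elim (¬hm (λ i 1≤i i≤0 → ⊥-elim (<⇒≱ 1≤i i≤0)))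
placements-noRows≡0 f (suc v) D ¬hm with f (suc v) in fv≡
... | suc q = cong (_* placements (λ _ → 0) f v (D + suc q))
                   (binomDiff-large {0} {D} {suc q} (subst (0 <_) (sym (+-suc D q)) z<s))
... | zero  = trans (cong (binomDiff 0 D 0 *_) (placements-noRows≡0 f v (D + 0) ¬hm′))
                    (*-zeroʳ (binomDiff 0 D 0))
  where
  ¬hm′ : ¬ HasMults v f []
  ¬hm′ hm = ¬hm (HasMults-suc {r = []} hm (sym fv≡))

countResiduals≡placements : ∀ M cs → All (_≤ M) cs → ∀ f →
                            countResiduals M cs f ≡ placements (rowsAtLeast cs) f M 0
countResiduals≡placements M [] [] f with hasMults? M f []
... | yes hm  = sym (placements-noRows≡1 f M hm)
... | no  ¬hm = sym (placements-noRows≡0 f M 0 ¬hm)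
countResiduals≡placements M (k ∷ ks) (k≤M ∷ ks≤M) f = begin
  countResiduals M (k ∷ ks) f
    ≡⟨ countResiduals-∷ M k ks f k≤M ⟩
  countResiduals M ks f + sumBelow k (λ j → whenPos (f (suc j)) (countResiduals M ks (decAt (suc j) f)))
    ≡⟨ cong₂ _+_ (IH f) (sumBelow-cong k (λ j _ → cong (whenPos (f (suc j))) (IH (decAt (suc j) f)))) ⟩
  placements n f M 0 + sumBelow k (λ j → whenPos (f (suc j)) (placements n (decAt (suc j) f) M 0))
    ≡⟨ cong (placements n f M 0 +_) (sumBelow-cong k valueFits) ⟩
  placements n f M 0 + newRowTerms n f k M 0
    ≡⟨ sym (placements-addRow n f k (rowsAtLeast-antitone ks) M 0 z≤n) ⟩
  placements (rowsAtLeast (k ∷ ks)) f M 0 ∎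
  where
  open ≡-Reasoning
  n = rowsAtLeast ks

  IH : ∀ g → countResiduals M ks g ≡ placements n g M 0
  IH = countResiduals≡placements M ks ks≤M

  valueFits : ∀ j → j < k → whenPos (f (suc j)) (placements n (decAt (suc j) f) M 0) ≡
                            χ≤ (suc j) M * whenPos (f (suc j)) (placements n (decAt (suc j) f) M 0)
  valueFits j j<k rewrite χ≤-≤ (≤-trans j<k k≤M) = sym (*-identityˡ _)

module _ (cs c : List ℕ) where

  private
    r = zipWith _∸_ cs c

  residual-↭ : residual cs c ↭ filter pos? r
  residual-↭ = sortDesc-↭ (filter pos? r)

  mult-residual : ∀ i → 1 ≤ i → mult i (residual cs c) ≡ mult i r
  mult-residual i 1≤i = trans (mult-↭ i residual-↭) (mult-filter-pos i 1≤i r)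

  residual-descending : AllPairs _≥_ (residual cs c)
  residual-descending = sortDesc-descending (filter pos? r)

  sum-residual : sum (residual cs c) ≡ sum r
  sum-residual = trans (sum-↭ residual-↭) (sum-filter-pos r)

  residual-parts : ∀ {m} → All (_≤ m) cs → All (InRange m) (residual cs c)
  residual-parts cs≤m = All-resp-↭ (↭-sym residual-↭)
    (All.zip (All.all-filter pos? r , All.filter⁺ pos? (zipWith-∸-≤ cs c cs≤m)))

HasMults⇒mult≡ : ∀ {m xs ys} → All (InRange m) xs → All (InRange m) ys →
                 HasMults m (λ i → mult i ys) xs → ∀ i → mult i xs ≡ mult i ys
HasMults⇒mult≡ {m} {xs} {ys} xs∈ ys∈ hm i with (1 ≤? i) ×-dec (i ≤? m)
... | yes (1≤i , i≤m) = hm i 1≤i i≤m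
... | no  i∉          = trans (mult-out-of-range xs xs∈ i∉) (sym (mult-out-of-range ys ys∈ i∉))

module _ {m b γ δ} (γ-part : IsPartition m b γ) (δ-part : IsPartition m b δ) where

  private
    cs = caps m γ
    f = λ i → mult i δ

    caps≤m : All (_≤ m) cs
    caps≤m = ≤-refl ∷ All.map proj₂ (proj₁ γ-part)

    δ-descending : AllPairs _≥_ δ
    δ-descending = Linked⇒AllPairs (λ y≤x z≤y → ≤-trans z≤y y≤x) (proj₁ (proj₂ δ-part))

    toHasMults : ∀ c → (sum c ≡ m) × (residual cs c ≡ δ) → HasMults m f (zipWith _∸_ cs c)
    toHasMults c (_ , res≡δ) i 1≤i _ = trans (sym (mult-residual cs c i 1≤i)) (cong (mult i) res≡δ)

    fromHasMults : ∀ c → sum c + sum (zipWith _∸_ cs c) ≡ sum cs → HasMults m f (zipWith _∸_ cs c) →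
                   (sum c ≡ m) × (residual cs c ≡ δ)
    fromHasMults c sum≡ hm = sum-c≡m , res≡δ
      where
      res≡δ : residual cs c ≡ δ
      res≡δ = descending-mult-injective (residual-descending cs c) δ-descending
                (HasMults⇒mult≡ (residual-parts cs c caps≤m) (proj₁ δ-part)
                                (λ i 1≤i i≤m → trans (mult-residual cs c i 1≤i) (hm i 1≤i i≤m)))
      sum-c≡m : sum c ≡ m
      sum-c≡m = +-cancelʳ-≡ b (sum c) m (begin
        sum c + b                           ≡⟨ cong (sum c +_) (sym (proj₂ (proj₂ δ-part))) ⟩
        sum c + sum δ                       ≡⟨ cong ((sum c +_) ∘ sum) (sym res≡δ) ⟩
        sum c + sum (residual cs c)         ≡⟨ cong (sum c +_) (sum-residual cs c) ⟩
        sum c + sum (zipWith _∸_ cs c)      ≡⟨ sum≡ ⟩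
        m + sum γ                           ≡⟨ cong (m +_) (proj₂ (proj₂ γ-part)) ⟩
        m + b                               ∎)
        where open ≡-Reasoning

  a≡countResiduals : a m γ δ ≡ countResiduals m (caps m γ) (λ i → mult i δ)
  a≡countResiduals =
    length-filter-cong _ _ (All.map (λ {c} sum≡ → toHasMults c , fromHasMults c sum≡) (boxes-sum cs))

-- The closed formula

tailMult≡sumBelow : ∀ m i L → tailMult m i L ≡ sumBelow (suc m ∸ i) (λ k → mult (i + k) L)
tailMult≡sumBelow m i L = trans (cong sum (map-upTo _ (suc m ∸ i))) (sum-applyUpTo _ (suc m ∸ i))

tailMult-top : ∀ m L → tailMult m (suc m) L ≡ 0
tailMult-top m L =
  trans (tailMult≡sumBelow m (suc m) L) (cong (λ K → sumBelow K (λ k → mult (suc m + k) L)) (n∸n≡0 m))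

tailMult-unfold : ∀ m i L → i ≤ m → tailMult m i L ≡ mult i L + tailMult m (suc i) L
tailMult-unfold m i L i≤m = begin
  tailMult m i L
    ≡⟨ tailMult≡sumBelow m i L ⟩
  sumBelow (suc m ∸ i) (λ k → mult (i + k) L)
    ≡⟨ cong (λ K → sumBelow K (λ k → mult (i + k) L)) (+-∸-assoc 1 i≤m) ⟩
  mult (i + 0) L + sumBelow (m ∸ i) (λ k → mult (i + suc k) L)
    ≡⟨ cong₂ _+_ (cong (flip mult L) (+-identityʳ i)) (sumBelow-cong (m ∸ i) (λ k _ → cong (flip mult L) (+-suc i k))) ⟩
  mult i L + sumBelow (m ∸ i) (λ k → mult (suc i + k) L)
    ≡⟨ cong (mult i L +_) (sym (tailMult≡sumBelow m (suc i) L)) ⟩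
  mult i L + tailMult m (suc i) L ∎
  where open ≡-Reasoning

rowsAtLeast≡tailMult : ∀ m γ → All (_≤ m) γ → ∀ u → u ≤ suc m → rowsAtLeast γ u ≡ tailMult m u γ
rowsAtLeast≡tailMult m []      []          u _     = sym (trans (tailMult≡sumBelow m u []) (sumBelow-zero (suc m ∸ u)))
rowsAtLeast≡tailMult m (x ∷ γ) (x≤m ∷ γ≤m) u u≤1+m = sym (begin
  tailMult m u (x ∷ γ)
    ≡⟨ tailMult≡sumBelow m u (x ∷ γ) ⟩
  sumBelow K (λ k → mult (u + k) (x ∷ γ))
    ≡⟨ sumBelow-cong K (λ k _ → mult-∷ (u + k) x γ) ⟩
  sumBelow K (λ k → χ≡ x (u + k) + mult (u + k) γ)
    ≡⟨ sumBelow-+ K _ _ ⟩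
  sumBelow K (λ k → χ≡ x (u + k)) + sumBelow K (λ k → mult (u + k) γ)
    ≡⟨ cong₂ _+_ (sumBelow-χ≡-from K u x x<u+K) (sym (tailMult≡sumBelow m u γ)) ⟩
  χ≤ u x + tailMult m u γ
    ≡⟨ cong (χ≤ u x +_) (sym (rowsAtLeast≡tailMult m γ γ≤m u u≤1+m)) ⟩
  χ≤ u x + rowsAtLeast γ u ∎)
  where
  open ≡-Reasoning
  K = suc m ∸ u
  x<u+K : x < u + K
  x<u+K = subst (x <_) (sym (m+[n∸m]≡n u≤1+m)) (s≤s x≤m)

placements≡formula : ∀ m γ δ → All (_≤ m) γ →
                     placements (rowsAtLeast (caps m γ)) (λ i → mult i δ) m 0 ≡ formula m γ δ
placements≡formula m γ δ γ≤m = begin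
  placements n f m 0                      ≡⟨ cong (placements n f m) (sym (tailMult-top m δ)) ⟩
  placements n f m (tailMult m (suc m) δ) ≡⟨ placements≡product m ≤-refl ⟩
  formula m γ δ                           ∎
  where
  open ≡-Reasoning
  n = rowsAtLeast (caps m γ)
  f = λ i → mult i δ
  F = λ i → binomDiff (tailMult m i γ + 1) (tailMult m (suc i) δ) (mult i δ)

  placements≡product : ∀ v → v ≤ m → placements n f v (tailMult m (suc v) δ) ≡ product (map F (map suc (upTo v)))
  placements≡product zero    _   = refl
  placements≡product (suc v) v<m = begin
    binomDiff (n (suc v)) D (f (suc v)) * placements n f v (D + f (suc v))
      ≡⟨ cong₂ (λ p E → binomDiff p D (f (suc v)) * placements n f v E) rows used ⟩
    F (suc v) * placements n f v (tailMult m (suc v) δ)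
      ≡⟨ cong (F (suc v) *_) (placements≡product v (≤-trans (n≤1+n v) v<m)) ⟩
    F (suc v) * product (map F (map suc (upTo v)))
      ≡⟨ *-comm (F (suc v)) _ ⟩
    product (map F (map suc (upTo v))) * F (suc v)
      ≡⟨ sym (product-map-upTo-suc F v) ⟩
    product (map F (map suc (upTo (suc v)))) ∎
    where
    D = tailMult m (suc (suc v)) δ
    rows : n (suc v) ≡ tailMult m (suc v) γ + 1
    rows = begin
      χ≤ (suc v) m + rowsAtLeast γ (suc v) ≡⟨ cong (_+ rowsAtLeast γ (suc v)) (χ≤-≤ v<m) ⟩
      1 + rowsAtLeast γ (suc v)            ≡⟨ +-comm 1 _ ⟩
      rowsAtLeast γ (suc v) + 1            ≡⟨ cong (_+ 1) (rowsAtLeast≡tailMult m γ γ≤m (suc v) (s≤s (<⇒≤ v<m))) ⟩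
      tailMult m (suc v) γ + 1             ∎
    used : D + f (suc v) ≡ tailMult m (suc v) δ
    used = trans (+-comm D (f (suc v))) (sym (tailMult-unfold m (suc v) δ v<m))

lemma2 : (m b : ℕ) → 1 ≤ m → (γ δ : List ℕ) → IsPartition m b γ → IsPartition m b δ → a m γ δ ≡ formula m γ δ
lemma2 m b _ γ δ γ-part δ-part = begin
  a m γ δ                                      ≡⟨ a≡countResiduals γ-part δ-part ⟩
  countResiduals m (caps m γ) f                ≡⟨ countResiduals≡placements m (caps m γ) (≤-refl ∷ γ≤m) f ⟩
  placements (rowsAtLeast (caps m γ)) f m 0    ≡⟨ placements≡formula m γ δ γ≤m ⟩
  formula m γ δ                                ∎
  where
  open ≡-Reasoning
  f = λ i → mult i δ
  γ≤m = All.map proj₂ (proj₁ γ-part)
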